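{- Let $G$ be the footmarks graph of a set of computation walks of a deterministic Turing machine, and let $e$ be an edge of $G$ incident to a source node (a node with only outgoing edges) or a sink node (a node with only incoming edges). Then $e$ is an ex-pendant edge.
   Context: A deterministic Turing machine has states $Q$, tape alphabet $\Gamma$, transition function $\delta : (Q\setminus F)\times\Gamma \to \Gamma\times\{ -1,+1\}\times Q$; tape cells are indexed by integers and the head starts at cell $0$. A computation node is a 6-tuple $(i, q, \sigma, q^{\perp}, \sigma^{\perp}, t)$: $i=\mathrm{index}$ (head cell), $q$ current state, $\sigma$ current symbol of cell $i$, $q^{\perp},\sigma^{\perp}$ state and symbol at the previous transition at cell $i$, $t=\mathrm{tier}$ the number of transitions previously performed at cell $i$. A computation walk is the sequence of edges joining the computation nodes of consecutive steps of a run starting at cell $0$; the footmarks graph of a set of walks is the union of their edges together with incident nodes. The index of an edge $(u,w)$ is $\min(\mathrm{index}(u),\mathrm{index}(w))$. A node $v$ is a folding node if it has an incoming edge and an outgoing edge of equal index. An edge $e$ of index $i$ is left-pendant if no edge of the graph adjacent to $e$ has index $i-1$ and the endpoint of $e$ with cell index $i$ is not a folding node; it is right-pendant if no edge adjacent to $e$ has index $i+1$ and the endpoint of $e$ with cell index $i+1$ is not a folding node; it is ex-pendant if it is left-pendant or right-pendant. -}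

module Defs where

open import Data.Nat using (ℕ; zero; suc; _<_; _≤_)
open import Data.Fin using (Fin)
open import Data.Integer using (ℤ; _+_; _-_; _⊓_; 0ℤ; 1ℤ; -1ℤ)
import Data.Integer as ℤ
open import Data.Bool using (Bool; false; if_then_else_)
open import Data.Maybe using (Maybe; just; nothing)
import Data.Maybe as Maybe
open import Data.Product using (Σ; ∃; ∃-syntax; _×_; _,_; proj₁; proj₂)
open import Data.Sum using (_⊎_)
open import Relation.Nullary using (¬_; yes; no; does)
open import Relation.Binary.PropositionalEquality using (_≡_)

-- Deterministic Turing machines
-- States Q = Fin nQ, tape alphabet Γ = Fin nΓ, final states F given by
-- the Boolean predicate 'final'; the transition function is defined
-- only on non-final states:  δ : (Q ∖ F) × Γ → Γ × {-1,+1} × Q.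

data Move : Set where
  L R : Move

moveℤ : Move → ℤ
moveℤ L = -1ℤ
moveℤ R = 1ℤ

record TM (nQ nΓ : ℕ) : Set where
  field
    final : Fin nQ → Bool
    δ     : (q : Fin nQ) → final q ≡ false → Fin nΓ → Fin nΓ × Move × Fin nQ

module _ {nQ nΓ : ℕ} (M : TM nQ nΓ) where
  open TM M

  Q Γ : Set
  Q = Fin nQ
  Γ = Fin nΓ

  record Config : Set where
    constructor mkConfig
    field
      state : Q
      tape  : ℤ → Γ
      head  : ℤ
  open Config public

  update : (ℤ → Γ) → ℤ → Γ → (ℤ → Γ)
  update τ i γ j = if does (j ℤ.≟ i) then γ else τ j

  Step : Config → Config → Set
  Step c c' =
    Σ (final (state c) ≡ false) λ nf →
      let r = δ (state c) nf (tape c (head c))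
          γ = proj₁ r
          d = proj₁ (proj₂ r)
          q = proj₂ (proj₂ r)
      in (state c' ≡ q)
         × (head c' ≡ head c + moveℤ d)
         × (∀ j → tape c' j ≡ update (tape c) (head c) γ j)

  -- A (finite) run starting at cell 0: configurations conf 0 … conf len,
  -- consecutive ones related by a transition.  Initial state and tape
  -- contents are arbitrary.
  record Run : Set where
    field
      len   : ℕ
      conf  : ℕ → Config
      start : head (conf 0) ≡ 0ℤ
      steps : ∀ s → s < len → Step (conf s) (conf (suc s))
  open Run public

  -- Computation nodes (i, q, σ, q⊥, σ⊥, t); ⊥ is 'nothing'.
  record Node : Set where
    constructor mkNode
    field
      index     : ℤ
      cur       : Q
      sym       : Γ
      prevState : Maybe Q
      prevSym   : Maybe Γ
      tier      : ℕ
  open Node public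

  tierAt : (ℕ → Config) → ℤ → ℕ → ℕ
  tierAt c i zero = zero
  tierAt c i (suc s) =
    if does (head (c s) ℤ.≟ i) then suc (tierAt c i s) else tierAt c i s

  lastAt : (ℕ → Config) → ℤ → ℕ → Maybe (Q × Γ)
  lastAt c i zero = nothing
  lastAt c i (suc s) with head (c s) ℤ.≟ i
  ... | yes _ = just (state (c s) , tape (c s) i)
  ... | no  _ = lastAt c i s

  nodeAt : Run → ℕ → Node
  nodeAt r s =
    let c = conf r
        i = head (c s)
    in mkNode i (state (c s)) (tape (c s) i)
              (Maybe.map proj₁ (lastAt c i s))
              (Maybe.map proj₂ (lastAt c i s))
              (tierAt c i s)

  Edge : Set
  Edge = Node × Node

  src tgt : Edge → Node
  src = proj₁
  tgt = proj₂

  WalkEdge : Run → Edge → Set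
  WalkEdge r e = ∃[ s ] (s < len r × nodeAt r s ≡ src e × nodeAt r (suc s) ≡ tgt e)

  -- footmarks graph of a set W of computation walks (given by their runs):
  -- its edges are the union of the walks' edges; its nodes are the
  -- endpoints of those edges.
  module Footmarks (W : Run → Set) where

    InG : Edge → Set
    InG e = ∃[ r ] (W r × WalkEdge r e)

    Incident : Node → Edge → Set
    Incident v e = (v ≡ src e) ⊎ (v ≡ tgt e)

    Adjacent : Edge → Edge → Set
    Adjacent e e' = ∃[ v ] (Incident v e × Incident v e')

    edgeIndex : Edge → ℤ
    edgeIndex e = index (src e) ⊓ index (tgt e)

    HasIn HasOut : Node → Set
    HasIn  v = ∃[ e ] (InG e × tgt e ≡ v)
    HasOut v = ∃[ e ] (InG e × src e ≡ v)

    Source Sink : Node → Set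
    Source v = HasOut v × ¬ HasIn v
    Sink   v = HasIn v × ¬ HasOut v

    Folding : Node → Set
    Folding v = ∃[ e₁ ] ∃[ e₂ ] (InG e₁ × InG e₂ × tgt e₁ ≡ v × src e₂ ≡ v
                                 × edgeIndex e₁ ≡ edgeIndex e₂)

    LeftPendant : Edge → Set
    LeftPendant e =
      (¬ (∃[ e' ] (InG e' × Adjacent e e' × edgeIndex e' ≡ edgeIndex e - 1ℤ)))
      × (∀ v → Incident v e → index v ≡ edgeIndex e → ¬ Folding v)

    RightPendant : Edge → Set
    RightPendant e =
      (¬ (∃[ e' ] (InG e' × Adjacent e e' × edgeIndex e' ≡ edgeIndex e + 1ℤ)))
      × (∀ v → Incident v e → index v ≡ edgeIndex e + 1ℤ → ¬ Folding v)

    ExPendant : Edge → Set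
    ExPendant e = LeftPendant e ⊎ RightPendant e

-- A computation node determines the cell the head visits next (through δ) and
-- also the cell it came from.  If the cell was visited before, the head left it
-- in the direction δ prescribed for the recorded state and symbol and, moving
-- one cell at a time, must come back from that same side; on a first visit it
-- arrives from the side of the origin.  Hence all edges at a source (all
-- outgoing) or at a sink (all incoming) have one and the same index, and such
-- a node is not folding.  An edge with an endpoint of this kind is ex-pendant:
-- every edge adjacent to it at its other endpoint lies on the far side of it.
module Submission where

open import Defs renaming (sym to nodeSym)
open import Data.Nat using (ℕ; zero; suc; z≤n; s≤s; _<_; _≤_; _≤′_; ≤′-refl; ≤′-step)
import Data.Nat.Properties as ℕ
open import Data.Integer using (ℤ; +_; +[1+_]; -[1+_]; _+_; _-_; _⊓_; 0ℤ; 1ℤ; -1ℤ; +<+; -<+)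
import Data.Integer as ℤ
import Data.Integer.Properties as ℤ
open import Data.Bool using (false; true)
import Data.Bool.Properties as Bool
open import Data.Maybe using (Maybe; just; nothing)
import Data.Maybe as Maybe
open import Data.Product using (∃-syntax; _×_; _,_; proj₁; proj₂)
open import Data.Sum using (_⊎_; inj₁; inj₂)
import Data.Sum as Sum
open import Function using (_∘_)
open import Relation.Nullary using (¬_; yes; no; contradiction)
open import Relation.Binary.PropositionalEquality
open import Axiom.UniquenessOfIdentityProofs using (module Decidable⇒UIP)

i<i+1 : ∀ i → i ℤ.< i + 1ℤ
i<i+1 i = subst (ℤ._< i + 1ℤ) (ℤ.+-identityʳ i) (ℤ.+-monoʳ-< i (+<+ (s≤s z≤n)))

i-1<i : ∀ i → i - 1ℤ ℤ.< i
i-1<i i = subst (i - 1ℤ ℤ.<_) (ℤ.+-identityʳ i) (ℤ.+-monoʳ-< i -<+)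

i+1-1≡i : ∀ i → i + 1ℤ - 1ℤ ≡ i
i+1-1≡i i = trans (ℤ.+-assoc i 1ℤ -1ℤ) (ℤ.+-identityʳ i)

i-1+1≡i : ∀ i → i - 1ℤ + 1ℤ ≡ i
i-1+1≡i i = trans (ℤ.+-assoc i -1ℤ 1ℤ) (ℤ.+-identityʳ i)

x+move≢x : ∀ x d → x + moveℤ d ≢ x
x+move≢x x R eq = ℤ.<⇒≢ (i<i+1 x) (sym eq)
x+move≢x x L eq = ℤ.<⇒≢ (i-1<i x) eq

neighbour-⊓ : ∀ {x y w} d → y ≡ x + moveℤ d → w ≡ x ⊎ w ≡ y →
  w ≡ x ⊓ y ⊎ w ≡ x ⊓ y + 1ℤ
neighbour-⊓ {x} R refl w∈xy with ℤ.i≤j⇒i⊓j≡i (ℤ.<⇒≤ (i<i+1 x))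
... | min≡x = Sum.map (λ w≡x → trans w≡x (sym min≡x))
                      (λ w≡y → trans w≡y (cong (_+ 1ℤ) (sym min≡x))) w∈xy
neighbour-⊓ {x} L refl w∈xy with ℤ.i≥j⇒i⊓j≡j (ℤ.<⇒≤ (i-1<i x))
... | min≡y = Sum.swap (Sum.map
  (λ w≡x → trans w≡x (trans (sym (i-1+1≡i x)) (cong (_+ 1ℤ) (sym min≡y))))
  (λ w≡y → trans w≡y (sym min≡y)) w∈xy)

OnSide : Move → ℤ → ℤ → Set
OnSide R j x = j ℤ.< x
OnSide L j x = x ℤ.< j

onSide-move : ∀ d j → OnSide d j (j + moveℤ d)
onSide-move R j = i<i+1 j
onSide-move L j = i-1<i j

onSide-step : ∀ d d' {j x} → OnSide d j x → x + moveℤ d' ≢ j → OnSide d j (x + moveℤ d')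
onSide-step R R j<x _ = ℤ.<-trans j<x (i<i+1 _)
onSide-step R L {j} {x} j<x ≢j =
  ℤ.≤∧≢⇒< (subst (j ℤ.≤_) (ℤ.+-comm -1ℤ x) (ℤ.i<j⇒i≤pred[j] j<x)) (≢j ∘ sym)
onSide-step L R {j} {x} x<j ≢j =
  ℤ.≤∧≢⇒< (subst (ℤ._≤ j) (ℤ.+-comm 1ℤ x) (ℤ.i<j⇒suc[i]≤j x<j)) ≢j
onSide-step L L x<j _ = ℤ.<-trans (i-1<i _) x<j

onSide-arrive : ∀ d d' {j x} → OnSide d j x → x + moveℤ d' ≡ j → x ≡ j + moveℤ d
onSide-arrive R R {x = x} j<x refl = contradiction (i<i+1 x) (ℤ.<-asym j<x)
onSide-arrive R L {x = x} _ refl = sym (i-1+1≡i x)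
onSide-arrive L R {x = x} _ refl = sym (i+1-1≡i x)
onSide-arrive L L {x = x} x<j refl = contradiction (i-1<i x) (ℤ.<-asym x<j)

-- junk value at j = 0, a cell the head never enters for the first time
originSide : ℤ → Move
originSide (+ _)     = L
originSide -[1+ _ ] = R

onSide-origin : ∀ j → j ≢ 0ℤ → OnSide (originSide j) j 0ℤ
onSide-origin (+ zero)   j≢0 = contradiction refl j≢0
onSide-origin +[1+ _ ] _   = +<+ (s≤s z≤n)
onSide-origin -[1+ _ ] _   = -<+

module UnitWalk (hs : ℕ → ℤ) (len : ℕ)
                (unit : ∀ k → k < len → ∃[ d ] hs (suc k) ≡ hs k + moveℤ d) where

  staysOnSide : ∀ {d j s₀ s} → s₀ ≤′ s → s ≤ len → (∀ k → s₀ ≤ k → k ≤ s → hs k ≢ j) →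
    OnSide d j (hs s₀) → OnSide d j (hs s)
  staysOnSide ≤′-refl _ _ side = side
  staysOnSide {d} (≤′-step s₀≤′s) s<len avoids side with unit _ s<len
  ... | d' , next = subst (OnSide d _) (sym next) (onSide-step d d'
    (staysOnSide s₀≤′s (ℕ.<⇒≤ s<len) (λ k s₀≤k k≤s → avoids k s₀≤k (ℕ.m≤n⇒m≤1+n k≤s)) side)
    (λ arrives → avoids _ (ℕ.≤′⇒≤ (≤′-step s₀≤′s)) ℕ.≤-refl (trans next arrives)))

  firstReturn : ∀ {d j s₀ s} → s₀ ≤ s → s < len → (∀ k → s₀ ≤ k → k ≤ s → hs k ≢ j) →
    OnSide d j (hs s₀) → hs (suc s) ≡ j → hs s ≡ j + moveℤ d
  firstReturn {d} s₀≤s s<len avoids side arrives with unit _ s<len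
  ... | d' , next = onSide-arrive d d'
    (staysOnSide (ℕ.≤⇒≤′ s₀≤s) (ℕ.<⇒≤ s<len) avoids side) (trans (sym next) arrives)

module _ {nQ nΓ : ℕ} (M : TM nQ nΓ) where
  open TM M

  moveAfter : ∀ q → Γ M → ∀ b → final q ≡ b → Move
  moveAfter q σ false nf = proj₁ (proj₂ (δ q nf σ))
  moveAfter q σ true  _  = L

  -- junk value L for a final state q
  moveOf : Q M → Γ M → Move
  moveOf q σ = moveAfter q σ (final q) refl

  moveOf-δ : ∀ q σ (nf : final q ≡ false) → moveOf q σ ≡ proj₁ (proj₂ (δ q nf σ))
  moveOf-δ q σ nf = moveAfter-δ (final q) refl
    where
      moveAfter-δ : ∀ b (fq≡b : final q ≡ b) → moveAfter q σ b fq≡b ≡ proj₁ (proj₂ (δ q nf σ))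
      moveAfter-δ false fq≡b =
        cong (λ p → proj₁ (proj₂ (δ q p σ))) (Decidable⇒UIP.≡-irrelevant Bool._≟_ fq≡b nf)
      moveAfter-δ true fq≡b = contradiction (trans (sym fq≡b) nf) λ ()

  step-head : ∀ {c c'} → Step M c c' →
    head c' ≡ head c + moveℤ (moveOf (state c) (tape c (head c)))
  step-head {c} (nf , _ , next , _) =
    trans next (cong (λ d → head c + moveℤ d) (sym (moveOf-δ (state c) (tape c (head c)) nf)))

  module _ (c : ℕ → Config M) (j : ℤ) where

    lastAt-nothing : ∀ n → lastAt M c j n ≡ nothing → ∀ k → k < n → head (c k) ≢ j
    lastAt-nothing (suc n) eq k k<1+n with head (c n) ℤ.≟ j
    lastAt-nothing (suc n) () k k<1+n | yes _
    ... | no cn≢j with ℕ.m<1+n⇒m<n∨m≡n k<1+n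
    ...   | inj₁ k<n  = lastAt-nothing n eq k k<n
    ...   | inj₂ refl = cn≢j

    lastAt-just : ∀ n {q σ} → lastAt M c j n ≡ just (q , σ) →
      ∃[ s ] (s < n × head (c s) ≡ j × state (c s) ≡ q × tape (c s) j ≡ σ
              × ∀ k → s < k → k < n → head (c k) ≢ j)
    lastAt-just (suc n) eq with head (c n) ℤ.≟ j
    lastAt-just (suc n) refl | yes cn≡j =
      n , ℕ.≤-refl , cn≡j , refl , refl ,
      λ k n<k k<1+n → contradiction (ℕ.m<1+n⇒m≤n k<1+n) (ℕ.<⇒≱ n<k)
    ... | no cn≢j with lastAt-just n eq
    ...   | s , s<n , cs≡j , cs≡q , cs≡σ , avoids =
      s , ℕ.m<n⇒m<1+n s<n , cs≡j , cs≡q , cs≡σ ,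
      λ k s<k k<1+n → Sum.[ avoids k s<k , (λ { refl → cn≢j }) ]′ (ℕ.m<1+n⇒m<n∨m≡n k<1+n)

  nextCell : Node M → ℤ
  nextCell v = index v + moveℤ (moveOf (cur v) (nodeSym v))

  -- the side from which the head enters a cell, given the state and symbol of
  -- the previous transition there (none: first visit)
  returnSide : Maybe (Q M) → Maybe (Γ M) → ℤ → Move
  returnSide (just q) (just σ) _ = moveOf q σ
  returnSide _        _        j = originSide j

  prevCell : Node M → ℤ
  prevCell v = index v + moveℤ (returnSide (prevState v) (prevSym v) (index v))

  module _ (r : Run M) where

    heads : ℕ → ℤ
    heads s = head (conf r s)

    heads-step : ∀ s → s < len r → heads (suc s) ≡ nextCell (nodeAt M r s)
    heads-step s s<len = step-head (steps r s s<len)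

    open UnitWalk heads (len r) (λ s s<len → _ , heads-step s s<len)

    arrival : ∀ s → s < len r → heads s ≡ prevCell (nodeAt M r (suc s))
    arrival s s<len = returnsFrom _ refl _ refl
      where
        returnsFrom : ∀ j → heads (suc s) ≡ j → ∀ l → lastAt M (conf r) j (suc s) ≡ l →
          heads s ≡ j + moveℤ (returnSide (Maybe.map proj₁ l) (Maybe.map proj₂ l) j)
        returnsFrom j arrives nothing eq =
          firstReturn z≤n s<len (λ k _ k≤s → avoids k (s≤s k≤s))
            (subst (OnSide _ j) (sym (start r)) (onSide-origin j j≢0)) arrives
          where
            avoids : ∀ k → k < suc s → heads k ≢ j
            avoids = lastAt-nothing (conf r) j (suc s) eq
            j≢0 : j ≢ 0ℤ
            j≢0 j≡0 = avoids 0 (s≤s z≤n) (trans (start r) (sym j≡0))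
        returnsFrom j arrives (just (q , σ)) eq with lastAt-just (conf r) j (suc s) eq
        ... | s' , s'<1+s , refl , refl , refl , avoids with ℕ.m<1+n⇒m<n∨m≡n s'<1+s
        ...   | inj₂ refl = contradiction (trans (sym (heads-step s s<len)) arrives)
                              (x+move≢x (heads s) _)
        ...   | inj₁ s'<s = firstReturn s'<s s<len (λ k s'<k k≤s → avoids k s'<k (s≤s k≤s))
                              (subst (OnSide _ j) (sym (heads-step s' (ℕ.<-trans s'<s s<len)))
                                 (onSide-move _ j))
                              arrives

  module _ (W : Run M → Set) where
    open Footmarks M W

    edge-next : ∀ {u w} → InG (u , w) → index w ≡ nextCell u
    edge-next (r , _ , s , s<len , refl , refl) = heads-step r s s<len

    edge-prev : ∀ {u w} → InG (u , w) → index u ≡ prevCell w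
    edge-prev (r , _ , s , s<len , refl , refl) = arrival r s s<len

    endpointIndex : ∀ {e v} → InG e → Incident v e →
      index v ≡ edgeIndex e ⊎ index v ≡ edgeIndex e + 1ℤ
    endpointIndex g v∈e = neighbour-⊓ _ (edge-next g) (Sum.map (cong index) (cong index) v∈e)

    edgeIndex≤index : ∀ {e v} → Incident v e → edgeIndex e ℤ.≤ index v
    edgeIndex≤index (inj₁ refl) = ℤ.i⊓j≤i _ _
    edgeIndex≤index (inj₂ refl) = ℤ.i⊓j≤j _ _

    index-1≤edgeIndex : ∀ {e v} → InG e → Incident v e → index v - 1ℤ ℤ.≤ edgeIndex e
    index-1≤edgeIndex g v∈e with endpointIndex g v∈e
    ... | inj₁ v≡i   = ℤ.≤-trans (ℤ.<⇒≤ (i-1<i _)) (ℤ.≤-reflexive v≡i)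
    ... | inj₂ v≡i+1 = ℤ.≤-reflexive (trans (cong (_- 1ℤ) v≡i+1) (i+1-1≡i _))

    endpoint-injective : ∀ {e u v} → InG e → Incident u e → Incident v e →
      index u ≡ index v → u ≡ v
    endpoint-injective g (inj₁ refl) (inj₁ refl) _  = refl
    endpoint-injective g (inj₂ refl) (inj₂ refl) _  = refl
    endpoint-injective g (inj₁ refl) (inj₂ refl) eq =
      contradiction (trans (sym (edge-next g)) (sym eq)) (x+move≢x _ _)
    endpoint-injective g (inj₂ refl) (inj₁ refl) eq =
      contradiction (trans (sym (edge-next g)) eq) (x+move≢x _ _)

    IndexConstantAt : Node M → ℤ → Set
    IndexConstantAt u i = ∀ e → InG e → Incident u e → edgeIndex e ≡ i

    lowEndpoint⇒leftPendant : ∀ {e u} → InG e → Incident u e → index u ≡ edgeIndex e →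
      ¬ Folding u → IndexConstantAt u (edgeIndex e) → LeftPendant e
    lowEndpoint⇒leftPendant {e} {u} g u∈e u≡i ¬fold const = noEdgeBelow , notFolding
      where
        i : ℤ
        i = edgeIndex e
        isU : ∀ {v} → Incident v e → index v ≡ i → v ≡ u
        isU v∈e v≡i = endpoint-injective g v∈e u∈e (trans v≡i (sym u≡i))
        adjacentAbove : ∀ {e' v} → InG e' → Incident v e → Incident v e' → i ℤ.≤ edgeIndex e'
        adjacentAbove g' v∈e v∈e' with endpointIndex g v∈e
        ... | inj₁ v≡i =
          ℤ.≤-reflexive (sym (const _ g' (subst (λ x → Incident x _) (isU v∈e v≡i) v∈e')))
        ... | inj₂ v≡i+1 = ℤ.≤-trans
          (ℤ.≤-reflexive (trans (sym (i+1-1≡i i)) (cong (_- 1ℤ) (sym v≡i+1))))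
          (index-1≤edgeIndex g' v∈e')
        noEdgeBelow : ¬ (∃[ e' ] (InG e' × Adjacent e e' × edgeIndex e' ≡ i - 1ℤ))
        noEdgeBelow (e' , g' , (v , v∈e , v∈e') , j≡i-1) =
          ℤ.<⇒≱ (i-1<i i) (subst (i ℤ.≤_) j≡i-1 (adjacentAbove g' v∈e v∈e'))
        notFolding : ∀ v → Incident v e → index v ≡ i → ¬ Folding v
        notFolding v v∈e v≡i = ¬fold ∘ subst Folding (isU v∈e v≡i)

    highEndpoint⇒rightPendant : ∀ {e u} → InG e → Incident u e → index u ≡ edgeIndex e + 1ℤ →
      ¬ Folding u → IndexConstantAt u (edgeIndex e) → RightPendant e
    highEndpoint⇒rightPendant {e} {u} g u∈e u≡i+1 ¬fold const = noEdgeAbove , notFolding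
      where
        i : ℤ
        i = edgeIndex e
        isU : ∀ {v} → Incident v e → index v ≡ i + 1ℤ → v ≡ u
        isU v∈e v≡i+1 = endpoint-injective g v∈e u∈e (trans v≡i+1 (sym u≡i+1))
        adjacentBelow : ∀ {e' v} → InG e' → Incident v e → Incident v e' → edgeIndex e' ℤ.≤ i
        adjacentBelow g' v∈e v∈e' with endpointIndex g v∈e
        ... | inj₁ v≡i   = ℤ.≤-trans (edgeIndex≤index v∈e') (ℤ.≤-reflexive v≡i)
        ... | inj₂ v≡i+1 =
          ℤ.≤-reflexive (const _ g' (subst (λ x → Incident x _) (isU v∈e v≡i+1) v∈e'))
        noEdgeAbove : ¬ (∃[ e' ] (InG e' × Adjacent e e' × edgeIndex e' ≡ i + 1ℤ))
        noEdgeAbove (e' , g' , (v , v∈e , v∈e') , j≡i+1) =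
          ℤ.<⇒≱ (i<i+1 i) (subst (ℤ._≤ i) j≡i+1 (adjacentBelow g' v∈e v∈e'))
        notFolding : ∀ v → Incident v e → index v ≡ i + 1ℤ → ¬ Folding v
        notFolding v v∈e v≡i+1 = ¬fold ∘ subst Folding (isU v∈e v≡i+1)

    indexConstant⇒exPendant : ∀ {e u} → InG e → Incident u e → ¬ Folding u →
      IndexConstantAt u (edgeIndex e) → ExPendant e
    indexConstant⇒exPendant g u∈e ¬fold const with endpointIndex g u∈e
    ... | inj₁ low  = inj₁ (lowEndpoint⇒leftPendant g u∈e low ¬fold const)
    ... | inj₂ high = inj₂ (highEndpoint⇒rightPendant g u∈e high ¬fold const)

    noIn⇒¬folding : ∀ {u} → ¬ HasIn u → ¬ Folding u
    noIn⇒¬folding noIn (e₁ , _ , g₁ , _ , e₁↦u , _) = noIn (e₁ , g₁ , e₁↦u)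

    noOut⇒¬folding : ∀ {u} → ¬ HasOut u → ¬ Folding u
    noOut⇒¬folding noOut (_ , e₂ , _ , g₂ , _ , u↦e₂ , _) = noOut (e₂ , g₂ , u↦e₂)

    noIn⇒edgeIndex : ∀ {e u} → ¬ HasIn u → InG e → Incident u e →
      edgeIndex e ≡ index u ⊓ nextCell u
    noIn⇒edgeIndex {u , _} _ g (inj₁ refl) = cong (index u ⊓_) (edge-next g)
    noIn⇒edgeIndex noIn g (inj₂ refl) = contradiction (_ , g , refl) noIn

    noOut⇒edgeIndex : ∀ {e u} → ¬ HasOut u → InG e → Incident u e →
      edgeIndex e ≡ prevCell u ⊓ index u
    noOut⇒edgeIndex noOut g (inj₁ refl) = contradiction (_ , g , refl) noOut
    noOut⇒edgeIndex {_ , w} _ g (inj₂ refl) = cong (_⊓ index w) (edge-prev g)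

    noIn⇒indexConstant : ∀ {e u} → ¬ HasIn u → InG e → Incident u e →
      IndexConstantAt u (edgeIndex e)
    noIn⇒indexConstant noIn g u∈e _ g' u∈e' =
      trans (noIn⇒edgeIndex noIn g' u∈e') (sym (noIn⇒edgeIndex noIn g u∈e))

    noOut⇒indexConstant : ∀ {e u} → ¬ HasOut u → InG e → Incident u e →
      IndexConstantAt u (edgeIndex e)
    noOut⇒indexConstant noOut g u∈e _ g' u∈e' =
      trans (noOut⇒edgeIndex noOut g' u∈e') (sym (noOut⇒edgeIndex noOut g u∈e))

mainTheorem6 : {nQ nΓ : ℕ} (M : TM nQ nΓ) (W : Run M → Set) (e : Edge M)
    → Footmarks.InG M W e
    → ∃[ v ] (Footmarks.Incident M W v e × (Footmarks.Source M W v ⊎ Footmarks.Sink M W v))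
    → Footmarks.ExPendant M W e
mainTheorem6 M W _ g (_ , u∈e , inj₁ (_ , noIn)) =
  indexConstant⇒exPendant M W g u∈e
    (noIn⇒¬folding M W noIn) (noIn⇒indexConstant M W noIn g u∈e)
mainTheorem6 M W _ g (_ , u∈e , inj₂ (_ , noOut)) =
  indexConstant⇒exPendant M W g u∈e
    (noOut⇒¬folding M W noOut) (noOut⇒indexConstant M W noOut g u∈e)
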